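{- Let $G=(V,E)$ be a $3$-regular bipartite graph that contains no cycle of length four. Then the edge vs stable set matrix $M(G)$ has a fooling set of size $|E|$.
   Context: Graphs are finite and simple. The edge vs stable set matrix $M(G)$ of a graph $G$ is the $0/1$ matrix with a row for each edge $e$ of $G$, a column for each stable set $S$ of $G$ (edges are regarded as 2-element vertex sets), and entry $1$ in position $(e,S)$ if and only if $e \cap S = \varnothing$. For a matrix $M$, its support is $\{(i,j) : M_{ij}\neq 0\}$. A fooling set for $M$ is a set $F$ of entries in the support of $M$ such that $M_{i\ell}\cdot M_{kj}=0$ for all distinct $(i,j),(k,\ell)\in F$. -}

module Defs where

open import Data.Bool using (Bool; true; false; if_then_else_; _∧_)
open import Data.Nat using (ℕ; _<_; _<ᵇ_)
open import Data.Fin using (Fin; toℕ)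
open import Data.Fin.Subset using (Subset; _∈_; _∉_)
open import Data.List using (List; map; allFin; length)
open import Data.Nat.ListAction using (sum)
open import Data.List.Membership.Propositional using () renaming (_∈_ to _∈ₗ_)
open import Data.Product using (Σ; _×_; _,_; ∃)
open import Relation.Binary.PropositionalEquality using (_≡_; _≢_)
open import Relation.Nullary using (¬_)
import Data.List.Relation.Unary.Unique.Propositional

record Graph : Set where
  field
    n     : ℕ
    adj   : Fin n → Fin n → Bool
    irrefl : ∀ u → adj u u ≡ false
    sym   : ∀ u v → adj u v ≡ adj v u
open Graph public

[_] : Bool → ℕ
[ b ] = if b then 1 else 0

degree : (G : Graph) → Fin (n G) → ℕ
degree G u = sum (map (λ v → [ adj G u v ]) (allFin (n G)))

numEdges : (G : Graph) → ℕ
numEdges G = sum (map (λ u → sum (map (λ v → [ (toℕ u <ᵇ toℕ v) ∧ adj G u v ]) (allFin (n G)))) (allFin (n G)))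

Cubic : Graph → Set
Cubic G = ∀ u → degree G u ≡ 3

Bipartite : Graph → Set
Bipartite G = Σ (Fin (n G) → Bool) λ c → ∀ u v → adj G u v ≡ true → c u ≢ c v

C4Free : Graph → Set
C4Free G = ∀ (a b c d : Fin (n G)) →
  a ≢ b → a ≢ c → a ≢ d → b ≢ c → b ≢ d → c ≢ d →
  ¬ (adj G a b ≡ true × adj G b c ≡ true × adj G c d ≡ true × adj G d a ≡ true)

IsEdge : (G : Graph) → Fin (n G) × Fin (n G) → Set
IsEdge G (u , v) = toℕ u < toℕ v × adj G u v ≡ true

Stable : (G : Graph) → Subset (n G) → Set
Stable G S = ∀ u v → u ∈ S → v ∈ S → adj G u v ≡ false

-- entry M(G)_{e,S} is 1 iff e ∩ S = ∅
Disjoint : (G : Graph) → Fin (n G) × Fin (n G) → Subset (n G) → Set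
Disjoint G (u , v) S = u ∉ S × v ∉ S

Entry : Graph → Set
Entry G = (Fin (n G) × Fin (n G)) × Subset (n G)

-- entry lies in the support of M(G) (and is a genuine position of M(G))
InSupport : (G : Graph) → Entry G → Set
InSupport G (e , S) = IsEdge G e × Stable G S × Disjoint G e S

record FoolingSet (G : Graph) : Set where
  field
    entries : List (Entry G)
    distinct : Data.List.Relation.Unary.Unique.Propositional.Unique entries
    support : ∀ x → x ∈ₗ entries → InSupport G x
    fooling : ∀ (e f : Fin (n G) × Fin (n G)) (S T : Subset (n G)) →
      (e , S) ∈ₗ entries → (f , T) ∈ₗ entries → (e , S) ≢ (f , T) →
      ¬ (Disjoint G e T × Disjoint G f S)
open FoolingSet public

size : ∀ {G} → FoolingSet G → ℕ
size F = length (entries F)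

-- König's theorem, proved by Kempe-chain recolouring, splits the edges of a cubic bipartite graph
-- into three perfect matchings μ₀, μ₁, μ₂.  Each edge ab, with a on a fixed side and of colour i,
-- gets a stable set consisting of one vertex w together with all vertices of one side that are not
-- adjacent to a vertex z: (w, z) is (μ₁μ₀a, μ₀a), (μ₁μ₀b, μ₀b) or (μ₀a, μ₀a) for i = 0, 1, 2.
-- If two distinct edges each missed the stable set of the other, then in each of the six colour
-- combinations the two edges would either coincide or lie on a common 4-cycle.
module Submission where

open import Data.Bool using (Bool; true; false; not; _∧_; _∨_; if_then_else_)
open import Data.Bool.Properties as B using (T-≡; T-∧; ¬-not; not-¬; not-involutive; not-injective; ∨-comm)
open import Data.Empty using (⊥; ⊥-elim)
open import Data.Fin using (Fin; zero; suc; toℕ; fromℕ<; punchOut; _≟_)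
open import Data.Fin.Permutation.Components using (transpose; transpose-inverse)
open import Data.Fin.Properties
  using (injective⇒≤; toℕ-injective; toℕ<n; toℕ-fromℕ<; punchOut-injective; any?; all?; ¬∀⟶∃¬)
open import Data.Fin.Subset using (Subset) renaming (_∈_ to _∈ₛ_; _∉_ to _∉ₛ_)
open import Data.List using (List; []; _∷_; _++_; length; lookup; map; filterᵇ; allFin; cartesianProduct)
open import Data.List.Membership.Propositional using (_∈_)
open import Data.List.Membership.Propositional.Properties
  using (∈-lookup; ∈-filter⁺; ∈-filter⁻; ∈-allFin; ∈-cartesianProduct⁺; ∈-map⁻)
open import Data.List.Properties using (filter-++; length-++; length-map; map-∘)
open import Data.List.Relation.Unary.All as All using (All; _∷_)
open import Data.List.Relation.Unary.AllPairs using (_∷_)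
open import Data.List.Relation.Unary.Any using (here; there; index)
open import Data.List.Relation.Unary.Any.Properties using (lookup-index)
open import Data.List.Relation.Unary.Unique.Propositional using (Unique)
open import Data.List.Relation.Unary.Unique.Propositional.Properties
  using (filter⁺; allFin⁺; cartesianProduct⁺; map⁺)
open import Data.Maybe using (Maybe; just; nothing; _>>=_)
open import Data.Maybe.Properties using (just-injective; ≡-dec)
open import Data.Nat using (ℕ; zero; suc; _≤_; _<_; _<ᵇ_; _+_; s≤s)
open import Data.Nat.ListAction using (sum)
open import Data.Nat.Properties
  using (<ᵇ⇒<; <⇒<ᵇ; <-cmp; <-asym; <⇒≱; ≤-pred; ≤-reflexive; m≤n⇒m<n∨m≡n)
open import Data.Product using (Σ; ∃; _×_; _,_; proj₁; proj₂; uncurry)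
open import Data.Product.Properties using () renaming (≡-dec to ×-≡-dec)
open import Data.Sum as Sum using (_⊎_; inj₁; inj₂)
open import Data.Vec using (tabulate)
open import Data.Vec.Properties using (lookup∘tabulate; []=⇒lookup; lookup⇒[]=)
open import Function using (_∘_; id; Injective)
open import Function.Bundles using (Equivalence)
open import Relation.Binary using (tri<; tri≈; tri>)
open import Relation.Binary.PropositionalEquality hiding ([_])
open import Relation.Nullary using (Dec; does; yes; no; ¬_; contradiction)
open import Relation.Nullary.Decidable
  using (T?; ¬?; _×-dec_; _⊎-dec_; dec-true; dec-false; decidable-stable)

open import Defs hiding (sym)

module _ {A : Set} where

  injective⇒≤length : ∀ {m} (xs : List A) (f : Fin m → A) →
    Injective _≡_ _≡_ f → (∀ i → f i ∈ xs) → m ≤ length xs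
  injective⇒≤length xs f f-inj f∈xs = injective⇒≤ index-injective
    where
    index-injective : Injective _≡_ _≡_ (λ i → index (f∈xs i))
    index-injective {i} {j} eq = f-inj (begin
      f i                           ≡⟨ lookup-index (f∈xs i) ⟩
      lookup xs (index (f∈xs i))    ≡⟨ cong (lookup xs) eq ⟩
      lookup xs (index (f∈xs j))    ≡⟨ lookup-index (f∈xs j) ⟨
      f j                           ∎)
      where open ≡-Reasoning

  lookup-injective : ∀ {xs : List A} → Unique xs → Injective _≡_ _≡_ (lookup xs)
  lookup-injective (_ ∷ _) {zero} {zero} _ = refl
  lookup-injective (x∉xs ∷ _) {zero} {suc j} eq = contradiction eq (All.lookup x∉xs (∈-lookup j))
  lookup-injective (x∉xs ∷ _) {suc i} {zero} eq = contradiction (sym eq) (All.lookup x∉xs (∈-lookup i))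
  lookup-injective (_ ∷ xs-unique) {suc i} {suc j} eq = cong suc (lookup-injective xs-unique eq)

  length-filterᵇ : (p : A → Bool) (xs : List A) → length (filterᵇ p xs) ≡ sum (map (λ x → [ p x ]) xs)
  length-filterᵇ p [] = refl
  length-filterᵇ p (x ∷ xs) with p x
  ... | true = cong suc (length-filterᵇ p xs)
  ... | false = length-filterᵇ p xs

length-filterᵇ-cartesianProduct : ∀ {A B : Set} (p : A × B → Bool) xs ys →
  length (filterᵇ p (cartesianProduct xs ys)) ≡ sum (map (λ x → sum (map (λ y → [ p (x , y) ]) ys)) xs)
length-filterᵇ-cartesianProduct p [] ys = refl
length-filterᵇ-cartesianProduct p (x ∷ xs) ys = begin
  length (filterᵇ p (map (x ,_) ys ++ cartesianProduct xs ys))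
    ≡⟨ cong length (filter-++ (T? ∘ p) (map (x ,_) ys) (cartesianProduct xs ys)) ⟩
  length (filterᵇ p (map (x ,_) ys) ++ filterᵇ p (cartesianProduct xs ys))
    ≡⟨ length-++ (filterᵇ p (map (x ,_) ys)) ⟩
  length (filterᵇ p (map (x ,_) ys)) + length (filterᵇ p (cartesianProduct xs ys))
    ≡⟨ cong₂ _+_ (length-filterᵇ p (map (x ,_) ys)) (length-filterᵇ-cartesianProduct p xs ys) ⟩
  sum (map (λ e → [ p e ]) (map (x ,_) ys)) + _
    ≡⟨ cong (λ zs → sum zs + _) (map-∘ ys) ⟨
  sum (map (λ y → [ p (x , y) ]) ys) + _ ∎
  where open ≡-Reasoning

module _ {k} {α β : Fin k} where

  transpose-injective : Injective _≡_ _≡_ (transpose α β)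
  transpose-injective {γ} {δ} eq =
    trans (sym (transpose-inverse β α)) (trans (cong (transpose β α) eq) (transpose-inverse β α))

  transpose-fixes : ∀ {γ} → γ ≢ α → γ ≢ β → transpose α β γ ≡ γ
  transpose-fixes {γ} γ≢α γ≢β rewrite dec-false (γ ≟ α) γ≢α | dec-false (γ ≟ β) γ≢β = refl

  transpose-β : α ≢ β → transpose α β β ≡ α
  transpose-β α≢β rewrite dec-false (β ≟ α) (α≢β ∘ sym) | dec-true (β ≟ β) refl = refl

  transpose≡α⇒≡β : α ≢ β → ∀ {γ} → transpose α β γ ≡ α → γ ≡ β
  transpose≡α⇒≡β α≢β eq = transpose-injective (trans eq (sym (transpose-β α≢β)))

module _ {m} {P : Fin m → Set} (P? : ∀ x → Dec (P x)) where

  subsetOf : Subset m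
  subsetOf = tabulate (does ∘ P?)

  ∈-subsetOf⁻ : ∀ {x} → x ∈ₛ subsetOf → P x
  ∈-subsetOf⁻ {x} x∈ = witness (P? x) (trans (sym (lookup∘tabulate (does ∘ P?) x)) ([]=⇒lookup x∈))
    where
    witness : ∀ {A : Set} (a? : Dec A) → does a? ≡ true → A
    witness (yes a) _ = a

  ∉-subsetOf⁺ : ∀ {x} → ¬ P x → x ∉ₛ subsetOf
  ∉-subsetOf⁺ ¬Px x∈ = ¬Px (∈-subsetOf⁻ x∈)

  ∉-subsetOf⁻ : ∀ {x} → x ∉ₛ subsetOf → ¬ P x
  ∉-subsetOf⁻ {x} x∉ Px = x∉ (lookup⇒[]= x subsetOf (trans (lookup∘tabulate (does ∘ P?) x) (dec-true (P? x) Px)))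

module _ (G : Graph) where

  private
    V : Set
    V = Fin (n G)

  infix 4 _~_
  _~_ : V → V → Set
  u ~ v = adj G u v ≡ true

  ~-sym : ∀ {u v} → u ~ v → v ~ u
  ~-sym {u} {v} u~v = trans (Graph.sym G v u) u~v

  ~⇒≢ : ∀ {u v} → u ~ v → u ≢ v
  ~⇒≢ {u} u~u refl with trans (sym u~u) (irrefl G u)
  ... | ()

  neighbours : V → List V
  neighbours u = filterᵇ (adj G u) (allFin (n G))

  length-neighbours : ∀ u → length (neighbours u) ≡ degree G u
  length-neighbours u = length-filterᵇ (adj G u) (allFin (n G))

  ∈-neighbours⁺ : ∀ {u w} → u ~ w → w ∈ neighbours u
  ∈-neighbours⁺ {u} {w} u~w = ∈-filter⁺ (T? ∘ adj G u) (∈-allFin w) (Equivalence.from T-≡ u~w)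

  ∈-neighbours⁻ : ∀ {u w} → w ∈ neighbours u → u ~ w
  ∈-neighbours⁻ {u} w∈ = Equivalence.to T-≡ (proj₂ (∈-filter⁻ (T? ∘ adj G u) {xs = allFin (n G)} w∈))

  neighbours-unique : ∀ u → Unique (neighbours u)
  neighbours-unique u = filter⁺ (T? ∘ adj G u) (allFin⁺ (n G))

  isEdgeᵇ : V × V → Bool
  isEdgeᵇ (u , v) = (toℕ u <ᵇ toℕ v) ∧ adj G u v

  private
    vertexPairs : List (V × V)
    vertexPairs = cartesianProduct (allFin (n G)) (allFin (n G))

  edges : List (V × V)
  edges = filterᵇ isEdgeᵇ vertexPairs

  length-edges : length edges ≡ numEdges G
  length-edges = length-filterᵇ-cartesianProduct isEdgeᵇ (allFin (n G)) (allFin (n G))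

  edges-unique : Unique edges
  edges-unique = filter⁺ (T? ∘ isEdgeᵇ) (cartesianProduct⁺ (allFin⁺ (n G)) (allFin⁺ (n G)))

  ∈-edges⁻ : ∀ {e} → e ∈ edges → IsEdge G e
  ∈-edges⁻ {u , v} e∈ with Equivalence.to T-∧ (proj₂ (∈-filter⁻ (T? ∘ isEdgeᵇ) {xs = vertexPairs} e∈))
  ... | u<v , u~v = <ᵇ⇒< (toℕ u) (toℕ v) u<v , Equivalence.to T-≡ u~v

  ∈-edges⁺ : ∀ {e} → IsEdge G e → e ∈ edges
  ∈-edges⁺ {u , v} (u<v , u~v) = ∈-filter⁺ (T? ∘ isEdgeᵇ) (∈-cartesianProduct⁺ (∈-allFin u) (∈-allFin v))
    (Equivalence.from T-∧ (<⇒<ᵇ u<v , Equivalence.from T-≡ u~v))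

  ~⇒∈-edges : ∀ {u v} → u ~ v → (u , v) ∈ edges ⊎ (v , u) ∈ edges
  ~⇒∈-edges {u} {v} u~v with <-cmp (toℕ u) (toℕ v)
  ... | tri< u<v _ _ = inj₁ (∈-edges⁺ (u<v , u~v))
  ... | tri≈ _ u≡v _ = contradiction (toℕ-injective u≡v) (~⇒≢ u~v)
  ... | tri> _ _ v<u = inj₂ (∈-edges⁺ (v<u , ~-sym u~v))

  record ProperColouring (H : V → V → Set) (k : ℕ) : Set where
    field
      colour : V → V → Fin k
      colour-sym : ∀ {x y} → H x y → colour x y ≡ colour y x
      colour-injective : ∀ {x y z} → H x y → H x z → colour x y ≡ colour x z → y ≡ z

  open ProperColouring

  restrict : ∀ {H₁ H₂ k} → (∀ {x y} → H₂ x y → H₁ x y) → ProperColouring H₁ k → ProperColouring H₂ k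
  restrict H₂⊆H₁ K = record
    { colour = colour K
    ; colour-sym = colour-sym K ∘ H₂⊆H₁
    ; colour-injective = λ Hxy Hxz → colour-injective K (H₂⊆H₁ Hxy) (H₂⊆H₁ Hxz)
    }

  Missing : ∀ {H k} → ProperColouring H k → V → Fin k → Set
  Missing {H} K u γ = ∀ w → H u w → colour K u w ≢ γ

  Joins : V → V → V → V → Set
  Joins u v x y = (x ≡ u × y ≡ v) ⊎ (x ≡ v × y ≡ u)

  module _ {k} {H : V → V → Set} (H-sym : ∀ {x y} → H x y → H y x) (K : ProperColouring H k)
    {u v γ} (u≢v : u ≢ v) (¬Huv : ¬ H u v) (u-misses : Missing K u γ) (v-misses : Missing K v γ) where

    private
      joins? : ∀ x y → Dec (Joins u v x y)
      joins? x y = (x ≟ u ×-dec y ≟ v) ⊎-dec (x ≟ v ×-dec y ≟ u)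

      colour⁺ : V → V → Fin k
      colour⁺ x y = if does (joins? x y) then γ else colour K x y

      colour⁺-new : ∀ {x y} → Joins u v x y → colour⁺ x y ≡ γ
      colour⁺-new {x} {y} uv rewrite dec-true (joins? x y) uv = refl

      H⇒¬Joins : ∀ {x y} → H x y → ¬ Joins u v x y
      H⇒¬Joins Huv (inj₁ (refl , refl)) = ¬Huv Huv
      H⇒¬Joins Hvu (inj₂ (refl , refl)) = ¬Huv (H-sym Hvu)

      colour⁺-old : ∀ {x y} → H x y → colour⁺ x y ≡ colour K x y
      colour⁺-old {x} {y} Hxy rewrite dec-false (joins? x y) (H⇒¬Joins Hxy) = refl

      joins-sym : ∀ {x y} → Joins u v x y → Joins u v y x
      joins-sym (inj₁ (x≡u , y≡v)) = inj₂ (y≡v , x≡u)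
      joins-sym (inj₂ (x≡v , y≡u)) = inj₁ (y≡u , x≡v)

      old≢new : ∀ {x y z} → H x y → Joins u v x z → colour K x y ≢ γ
      old≢new {y = y} Huy (inj₁ (refl , _)) = u-misses y Huy
      old≢new {y = y} Hvy (inj₂ (refl , _)) = v-misses y Hvy

      joins-functional : ∀ {x y z} → Joins u v x y → Joins u v x z → y ≡ z
      joins-functional (inj₁ (refl , refl)) (inj₁ (_ , refl)) = refl
      joins-functional (inj₁ (refl , refl)) (inj₂ (u≡v , _)) = contradiction u≡v u≢v
      joins-functional (inj₂ (refl , refl)) (inj₁ (v≡u , _)) = contradiction (sym v≡u) u≢v
      joins-functional (inj₂ (refl , refl)) (inj₂ (_ , refl)) = refl

    addEdge : ProperColouring (λ x y → H x y ⊎ Joins u v x y) k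
    addEdge = record { colour = colour⁺ ; colour-sym = sym⁺ ; colour-injective = injective⁺ }
      where
      sym⁺ : ∀ {x y} → H x y ⊎ Joins u v x y → colour⁺ x y ≡ colour⁺ y x
      sym⁺ (inj₁ Hxy) = trans (colour⁺-old Hxy) (trans (colour-sym K Hxy) (sym (colour⁺-old (H-sym Hxy))))
      sym⁺ (inj₂ uv) = trans (colour⁺-new uv) (sym (colour⁺-new (joins-sym uv)))

      injective⁺ : ∀ {x y z} → H x y ⊎ Joins u v x y → H x z ⊎ Joins u v x z → colour⁺ x y ≡ colour⁺ x z → y ≡ z
      injective⁺ (inj₁ Hxy) (inj₁ Hxz) eq =
        colour-injective K Hxy Hxz (trans (sym (colour⁺-old Hxy)) (trans eq (colour⁺-old Hxz)))
      injective⁺ (inj₁ Hxy) (inj₂ uv) eq =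
        contradiction (trans (sym (colour⁺-old Hxy)) (trans eq (colour⁺-new uv))) (old≢new Hxy uv)
      injective⁺ (inj₂ uv) (inj₁ Hxz) eq =
        contradiction (trans (sym (colour⁺-old Hxz)) (trans (sym eq) (colour⁺-new uv))) (old≢new Hxz uv)
      injective⁺ (inj₂ uv) (inj₂ uv′) _ = joins-functional uv uv′

  module _ {k} {H : V → V → Set} (H? : ∀ x y → Dec (H x y))
    (H-sym : ∀ {x y} → H x y → H y x) (H⊆~ : ∀ {x y} → H x y → x ~ y) (K : ProperColouring H k) where

    private
      HasColour : Fin k → V → V → Set
      HasColour γ x w = H x w × colour K x w ≡ γ

      hasColour? : ∀ γ x w → Dec (HasColour γ x w)
      hasColour? γ x w = H? x w ×-dec colour K x w ≟ γ

    -- With all k colours present at u, the extra neighbour v gives u at least k + 1 neighbours.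
    missingColour : (∀ u → degree G u ≤ k) → ∀ {u v} → u ~ v → ¬ H u v → ∃ (Missing K u)
    missingColour Δ≤k {u} {v} u~v ¬Huv with all? (λ γ → any? (hasColour? γ u))
    ... | no ¬allPresent = let γ , γ-absent = ¬∀⟶∃¬ k _ (λ γ → any? (hasColour? γ u)) ¬allPresent in
      γ , λ w Huw uw≡γ → γ-absent (w , Huw , uw≡γ)
    ... | yes allPresent = contradiction (injective⇒≤length (neighbours u) nbr nbr-injective nbr∈) k+1≰degree
      where
      nbr : Fin (suc k) → V
      nbr zero = v
      nbr (suc γ) = proj₁ (allPresent γ)

      nbr-colour : ∀ γ → HasColour γ u (nbr (suc γ))
      nbr-colour γ = proj₂ (allPresent γ)

      nbr-injective : Injective _≡_ _≡_ nbr
      nbr-injective {zero} {zero} _ = refl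
      nbr-injective {zero} {suc γ} refl = contradiction (proj₁ (nbr-colour γ)) ¬Huv
      nbr-injective {suc γ} {zero} refl = contradiction (proj₁ (nbr-colour γ)) ¬Huv
      nbr-injective {suc γ} {suc δ} eq =
        cong suc (trans (sym (proj₂ (nbr-colour γ))) (trans (cong (colour K u) eq) (proj₂ (nbr-colour δ))))

      nbr∈ : ∀ i → nbr i ∈ neighbours u
      nbr∈ zero = ∈-neighbours⁺ u~v
      nbr∈ (suc γ) = ∈-neighbours⁺ (H⊆~ (proj₁ (nbr-colour γ)))

      k+1≰degree : ¬ suc k ≤ length (neighbours u)
      k+1≰degree k+1≤ = <⇒≱ (subst (suc k ≤_) (length-neighbours u) k+1≤) (Δ≤k u)

    partner : Fin k → V → Maybe V
    partner γ x with any? (hasColour? γ x)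
    ... | yes (w , _) = just w
    ... | no _ = nothing

    partner⁻ : ∀ {γ x w} → partner γ x ≡ just w → H x w × colour K x w ≡ γ
    partner⁻ {γ} {x} eq with any? (hasColour? γ x)
    partner⁻ refl | yes (_ , Hxw , xw≡γ) = Hxw , xw≡γ

    partner⁺ : ∀ {γ x w} → H x w → colour K x w ≡ γ → partner γ x ≡ just w
    partner⁺ {γ} {x} {w} Hxw xw≡γ with any? (hasColour? γ x)
    ... | yes (w′ , Hxw′ , xw′≡γ) = cong just (colour-injective K Hxw′ Hxw (trans xw′≡γ (sym xw≡γ)))
    ... | no none = contradiction (w , Hxw , xw≡γ) none

    partner-involutive : ∀ {γ x w} → partner γ x ≡ just w → partner γ w ≡ just x
    partner-involutive eq with partner⁻ eq
    ... | Hxw , xw≡γ = partner⁺ (H-sym Hxw) (trans (sym (colour-sym K Hxw)) xw≡γ)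

    module KempeChain (bipartite : Bipartite G)
      {u v α β} (u~v : u ~ v) (u-misses-α : Missing K u α) (v-misses-β : Missing K v β) (α≢β : α ≢ β) where

      private
        c : V → Bool
        c = proj₁ bipartite

        c-proper : ∀ {x y} → x ~ y → c x ≢ c y
        c-proper = proj₂ bipartite _ _

      even : ℕ → Bool
      even zero = true
      even (suc i) = not (even i)

      chainColour : ℕ → Fin k
      chainColour i = if even i then α else β

      -- The Kempe chain: the α/β-alternating walk leaving v along its α-edge, nothing once it gets stuck.
      chain : ℕ → Maybe V
      chain zero = just v
      chain (suc i) = chain i >>= partner (chainColour i)

      chain-suc⁻ : ∀ i {w} → chain (suc i) ≡ just w →
        ∃ λ w′ → chain i ≡ just w′ × partner (chainColour i) w′ ≡ just w
      chain-suc⁻ i eq with chain i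
      ... | just w′ = w′ , refl , eq

      chain-suc⁺ : ∀ i {w} → chain i ≡ just w → chain (suc i) ≡ partner (chainColour i) w
      chain-suc⁺ i eq = cong (_>>= partner (chainColour i)) eq

      sideAt : ℕ → Bool
      sideAt i = if even i then c v else not (c v)

      chain-side : ∀ i {w} → chain i ≡ just w → c w ≡ sideAt i
      chain-side zero refl = refl
      chain-side (suc i) eq with chain-suc⁻ i eq
      ... | w′ , eq′ , step = begin
        c _                    ≡⟨ ¬-not (c-proper (~-sym (H⊆~ (proj₁ (partner⁻ step))))) ⟩
        not (c w′)             ≡⟨ cong not (chain-side i eq′) ⟩
        not (sideAt i)         ≡⟨ not-sideAt i ⟩
        sideAt (suc i)         ∎
        where
        open ≡-Reasoning
        not-sideAt : ∀ i → not (sideAt i) ≡ sideAt (suc i)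
        not-sideAt i with even i
        ... | true = refl
        ... | false = not-involutive (c v)

      sideAt-injective : ∀ {i j} → sideAt i ≡ sideAt j → even i ≡ even j
      sideAt-injective {i} {j} eq with even i | even j
      ... | true | true = refl
      ... | false | false = refl
      ... | true | false = contradiction eq (not-¬ refl)
      ... | false | true = contradiction (sym eq) (not-¬ refl)

      chain-parity : ∀ i j {w} → chain i ≡ just w → chain j ≡ just w → even i ≡ even j
      chain-parity i j eqᵢ eqⱼ = sideAt-injective {i} {j} (trans (sym (chain-side i eqᵢ)) (chain-side j eqⱼ))

      chainColour-odd : ∀ {j} → even (suc j) ≡ true → chainColour j ≡ β
      chainColour-odd {j} eq with even j
      chainColour-odd () | true
      ... | false = refl

      chainColour-even : ∀ {j} → even (suc j) ≡ false → chainColour j ≡ α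
      chainColour-even {j} eq with even j
      ... | true = refl
      chainColour-even () | false

      -- The walk can only return to v along a β-edge, which v does not have.
      v-notReentered : ∀ j → chain (suc j) ≢ just v
      v-notReentered j eq with chain-suc⁻ j eq
      ... | w , _ , step with partner⁻ (partner-involutive step)
      ... | Hvw , vw≡cⱼ = v-misses-β w Hvw (trans vw≡cⱼ (chainColour-odd {j} (chain-parity (suc j) 0 eq refl)))

      chain-injective : ∀ i j {w} → chain i ≡ just w → chain j ≡ just w → i ≡ j
      chain-injective zero zero _ _ = refl
      chain-injective zero (suc j) refl eqⱼ = contradiction eqⱼ (v-notReentered j)
      chain-injective (suc i) zero eqᵢ refl = contradiction eqᵢ (v-notReentered i)
      chain-injective (suc i) (suc j) eqᵢ eqⱼ with chain-suc⁻ i eqᵢ | chain-suc⁻ j eqⱼ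
      ... | wᵢ , eqᵢ′ , stepᵢ | wⱼ , eqⱼ′ , stepⱼ =
        cong suc (chain-injective i j eqᵢ′ (trans eqⱼ′ (cong just (just-injective samePredecessor))))
        where
        sameColour : chainColour i ≡ chainColour j
        sameColour = cong (λ b → if b then α else β) (not-injective (chain-parity (suc i) (suc j) eqᵢ eqⱼ))
        samePredecessor : just wⱼ ≡ just wᵢ
        samePredecessor = begin
          just wⱼ                              ≡⟨ partner-involutive stepⱼ ⟨
          partner (chainColour j) _            ≡⟨ cong (λ γ → partner γ _) sameColour ⟨
          partner (chainColour i) _            ≡⟨ partner-involutive stepᵢ ⟩
          just wᵢ                              ∎
          where open ≡-Reasoning

      chain-prefix : ∀ {i w} → chain i ≡ just w → ∀ {j} → j ≤ i → ∃ λ w′ → chain j ≡ just w′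
      chain-prefix {i} {w} eq j≤i with m≤n⇒m<n∨m≡n j≤i
      ... | inj₂ refl = w , eq
      chain-prefix {suc i} eq _ | inj₁ (s≤s j≤i) = chain-prefix (proj₁ (proj₂ (chain-suc⁻ i eq))) j≤i

      chain-bounded : ∀ {i w} → chain i ≡ just w → i < n G
      chain-bounded {i} eq = injective⇒≤ {f = vertexAt} vertexAt-injective
        where
        vertexAt : Fin (suc i) → V
        vertexAt j = proj₁ (chain-prefix eq (≤-pred (toℕ<n j)))
        vertexAt-injective : Injective _≡_ _≡_ vertexAt
        vertexAt-injective {j} {j′} eq′ = toℕ-injective (chain-injective (toℕ j) (toℕ j′)
          (proj₂ (chain-prefix eq (≤-pred (toℕ<n j))))
          (trans (proj₂ (chain-prefix eq (≤-pred (toℕ<n j′)))) (cong just (sym eq′))))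

      InChain : V → Set
      InChain w = ∃ λ i → chain i ≡ just w

      inChain? : ∀ w → Dec (InChain w)
      inChain? w with any? (λ i → ≡-dec _≟_ (chain (toℕ i)) (just w))
      ... | yes (i , eq) = yes (toℕ i , eq)
      ... | no none = no (none ∘ bound)
        where
        bound : InChain w → ∃ λ (i : Fin (n G)) → chain (toℕ i) ≡ just w
        bound (i , eq) = fromℕ< i<n , trans (cong chain (toℕ-fromℕ< i<n)) eq
          where i<n = chain-bounded {i} eq

      chain-closed : ∀ {w w′} → InChain w → H w w′ → colour K w w′ ≡ α ⊎ colour K w w′ ≡ β → InChain w′
      chain-closed {w} {w′} (i , eq) Hww′ αβ with colour K w w′ ≟ chainColour i
      ... | yes ≡cᵢ = suc i , trans (chain-suc⁺ i eq) (partner⁺ Hww′ ≡cᵢ)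
      chain-closed (zero , refl) _ (inj₁ ≡α) | no ≢α = contradiction ≡α ≢α
      chain-closed {w′ = w′} (zero , refl) Hvw′ (inj₂ ≡β) | no _ = contradiction ≡β (v-misses-β w′ Hvw′)
      chain-closed {w} {w′} (suc i , eq) Hww′ αβ | no ≢cᵢ₊₁ with chain-suc⁻ i eq
      ... | w₀ , eq₀ , step =
        i , trans eq₀ (trans (sym (partner-involutive step)) (partner⁺ Hww′ (alternate αβ ≢cᵢ₊₁)))
        where
        alternate : ∀ {γ} → γ ≡ α ⊎ γ ≡ β → γ ≢ chainColour (suc i) → γ ≡ chainColour i
        alternate γ∈αβ γ≢ with even i
        alternate (inj₁ ≡α) _ | true = ≡α
        alternate (inj₂ ≡β) γ≢ | true = contradiction ≡β γ≢
        alternate (inj₁ ≡α) γ≢ | false = contradiction ≡α γ≢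
        alternate (inj₂ ≡β) _ | false = ≡β

      -- u lies on the side reached after an odd number of steps, i.e. along an α-edge, which u lacks.
      u-notInChain : ¬ InChain u
      u-notInChain (zero , eq) = ~⇒≢ u~v (sym (just-injective eq))
      u-notInChain (suc i , eq) with chain-suc⁻ i eq
      ... | w , _ , step with partner⁻ (partner-involutive step)
      ... | Huw , uw≡cᵢ = u-misses-α w Huw (trans uw≡cᵢ (chainColour-even {i} u-odd))
        where
        u-odd : even (suc i) ≡ false
        u-odd = sideAt-injective {suc i} {1} (trans (sym (chain-side (suc i) eq)) (¬-not (c-proper u~v)))

      private
        swapIf : Bool → Fin k → Fin k
        swapIf b = if b then transpose α β else id

        swapIf-injective : ∀ b → Injective _≡_ _≡_ (swapIf b)
        swapIf-injective true = transpose-injective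
        swapIf-injective false = id

        inChainᵇ : V → Bool
        inChainᵇ w = does (inChain? w)

        inChainᵇ-true : ∀ w → does (inChain? w) ≡ true → InChain w
        inChainᵇ-true w with inChain? w
        ... | yes w∈ = λ _ → w∈
        ... | no _ = λ ()

        swappedColour : V → V → Fin k
        swappedColour x y = swapIf (inChainᵇ x ∨ inChainᵇ y) (colour K x y)

        -- An α/β-edge has both ends in the chain or neither, and transpose α β fixes every other colour.
        swappedColour-local : ∀ {x y} → H x y →
          swapIf (inChainᵇ x ∨ inChainᵇ y) (colour K x y) ≡ swapIf (inChainᵇ x) (colour K x y)
        swappedColour-local {x} {y} Hxy with inChainᵇ x in x∈? | inChainᵇ y in y∈?
        ... | true | _ = refl
        ... | false | false = refl
        ... | false | true = transpose-fixes (x∉ ∘ reaches ∘ inj₁) (x∉ ∘ reaches ∘ inj₂)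
          where
          x∉ : ¬ InChain x
          x∉ x∈ = contradiction (trans (sym (dec-true (inChain? x) x∈)) x∈?) λ ()
          reaches : colour K x y ≡ α ⊎ colour K x y ≡ β → InChain x
          reaches = chain-closed (inChainᵇ-true y y∈?) (H-sym Hxy)
            ∘ Sum.map (trans (sym (colour-sym K Hxy))) (trans (sym (colour-sym K Hxy)))

      swapped : ProperColouring H k
      swapped = record
        { colour = swappedColour
        ; colour-sym = λ {x} {y} Hxy → cong₂ swapIf (∨-comm (inChainᵇ x) (inChainᵇ y)) (colour-sym K Hxy)
        ; colour-injective = λ {x} Hxy Hxz eq → colour-injective K Hxy Hxz (swapIf-injective (inChainᵇ x)
            (trans (sym (swappedColour-local Hxy)) (trans eq (swappedColour-local Hxz))))
        }

      swapped-missing-u : Missing swapped u α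
      swapped-missing-u w Huw eq = u-misses-α w Huw
        (subst (λ b → swapIf b (colour K u w) ≡ α) (dec-false (inChain? u) u-notInChain)
          (trans (sym (swappedColour-local Huw)) eq))

      swapped-missing-v : Missing swapped v α
      swapped-missing-v w Hvw eq = v-misses-β w Hvw (transpose≡α⇒≡β α≢β
        (subst (λ b → swapIf b (colour K v w) ≡ α) (dec-true (inChain? v) (0 , refl))
          (trans (sym (swappedColour-local Hvw)) eq)))

    extendByEdge : Bipartite G → (∀ u → degree G u ≤ k) →
      ∀ {u v} → u ~ v → ¬ H u v → ProperColouring (λ x y → H x y ⊎ Joins u v x y) k
    extendByEdge bipartite Δ≤k u~v ¬Huv
      with missingColour Δ≤k u~v ¬Huv | missingColour Δ≤k (~-sym u~v) (¬Huv ∘ H-sym)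
    ... | α , u-misses-α | β , v-misses-β with α ≟ β
    ... | yes refl = addEdge H-sym K (~⇒≢ u~v) ¬Huv u-misses-α v-misses-β
    ... | no α≢β = addEdge H-sym swapped (~⇒≢ u~v) ¬Huv swapped-missing-u swapped-missing-v
      where open KempeChain bipartite u~v u-misses-α v-misses-β α≢β

  EdgesIn : List (V × V) → V → V → Set
  EdgesIn L x y = (x , y) ∈ L ⊎ (y , x) ∈ L

  private
    edgesIn? : ∀ L x y → Dec (EdgesIn L x y)
    edgesIn? L x y = ((x , y) ∈? L) ⊎-dec ((y , x) ∈? L)
      where open import Data.List.Membership.DecPropositional (×-≡-dec (_≟_ {n G}) (_≟_ {n G})) using (_∈?_)

    edgesIn-sym : ∀ {L x y} → EdgesIn L x y → EdgesIn L y x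
    edgesIn-sym = Sum.swap

    edgesIn⊆~ : ∀ {L} → All (IsEdge G) L → ∀ {x y} → EdgesIn L x y → x ~ y
    edgesIn⊆~ L-edges (inj₁ xy∈) = proj₂ (All.lookup L-edges xy∈)
    edgesIn⊆~ L-edges (inj₂ yx∈) = ~-sym (proj₂ (All.lookup L-edges yx∈))

    edgesIn-∷ : ∀ {u v L x y} → EdgesIn ((u , v) ∷ L) x y → EdgesIn L x y ⊎ Joins u v x y
    edgesIn-∷ (inj₁ (here refl)) = inj₂ (inj₁ (refl , refl))
    edgesIn-∷ (inj₁ (there xy∈)) = inj₁ (inj₁ xy∈)
    edgesIn-∷ (inj₂ (here refl)) = inj₂ (inj₂ (refl , refl))
    edgesIn-∷ (inj₂ (there yx∈)) = inj₁ (inj₂ yx∈)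

  -- Colours of non-edges are junk, so at least one colour is needed even for an edgeless graph.
  colourEdges : ∀ {k} → Bipartite G → (∀ u → degree G u ≤ suc k) →
    ∀ L → All (IsEdge G) L → Unique L → ProperColouring (EdgesIn L) (suc k)
  colourEdges _ _ [] _ _ = record
    { colour = λ _ _ → zero
    ; colour-sym = λ { (inj₁ ()) ; (inj₂ ()) }
    ; colour-injective = λ { (inj₁ ()) _ _ ; (inj₂ ()) _ _ }
    }
  colourEdges bipartite Δ≤k ((u , v) ∷ L) ((u<v , u~v) ∷ L-edges) (uv∉L ∷ L-unique) =
    restrict edgesIn-∷ (extendByEdge (edgesIn? L) edgesIn-sym (edgesIn⊆~ L-edges)
      (colourEdges bipartite Δ≤k L L-edges L-unique) bipartite Δ≤k u~v ¬uv)
    where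
    ¬uv : ¬ EdgesIn L u v
    ¬uv (inj₁ uv∈) = All.lookup uv∉L uv∈ refl
    ¬uv (inj₂ vu∈) = <-asym u<v (proj₁ (All.lookup L-edges vu∈))

  bipartite⇒edgeColouring : ∀ {k} → Bipartite G → (∀ u → degree G u ≤ suc k) → ProperColouring _~_ (suc k)
  bipartite⇒edgeColouring bipartite Δ≤k =
    restrict ~⇒∈-edges (colourEdges bipartite Δ≤k edges (All.tabulate ∈-edges⁻) edges-unique)

  module PerfectMatchings {k} (K : ProperColouring _~_ (suc k)) (regular : ∀ u → degree G u ≡ suc k) where

    -- In a (k+1)-regular graph the k+1 neighbours of v carry distinct colours, so every colour occurs at v.
    colour-present : ∀ v i → ∃ λ w → v ~ w × colour K v w ≡ i
    colour-present v i with any? (λ w → adj G v w B.≟ true ×-dec colour K v w ≟ i)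
    ... | yes present = present
    ... | no absent = contradiction (injective⇒≤ {f = otherColour} otherColour-injective) degree≰k
      where
      nbr : Fin (length (neighbours v)) → V
      nbr = lookup (neighbours v)

      v~nbr : ∀ j → v ~ nbr j
      v~nbr j = ∈-neighbours⁻ (∈-lookup j)

      i≢colour : ∀ j → i ≢ colour K v (nbr j)
      i≢colour j i≡ = absent (nbr j , v~nbr j , sym i≡)

      otherColour : Fin (length (neighbours v)) → Fin k
      otherColour j = punchOut (i≢colour j)

      otherColour-injective : Injective _≡_ _≡_ otherColour
      otherColour-injective {j} {j′} eq = lookup-injective (neighbours-unique v)
        (colour-injective K (v~nbr j) (v~nbr j′) (punchOut-injective (i≢colour j) (i≢colour j′) eq))

      degree≰k : ¬ length (neighbours v) ≤ k
      degree≰k ≤k = <⇒≱ (≤-reflexive (sym (trans (length-neighbours v) (regular v)))) ≤k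

    opaque
      mate : Fin (suc k) → V → V
      mate i v = proj₁ (colour-present v i)

      ~mate : ∀ i v → v ~ mate i v
      ~mate i v = proj₁ (proj₂ (colour-present v i))

      colour-mate : ∀ i v → colour K v (mate i v) ≡ i
      colour-mate i v = proj₂ (proj₂ (colour-present v i))

    ~⇒mate : ∀ {v w} → v ~ w → w ≡ mate (colour K v w) v
    ~⇒mate {v} {w} v~w = colour-injective K v~w (~mate _ v) (sym (colour-mate _ v))

    mate-involutive : ∀ i v → mate i (mate i v) ≡ v
    mate-involutive i v = sym (begin
      v                                       ≡⟨ ~⇒mate (~-sym (~mate i v)) ⟩
      mate (colour K (mate i v) v) (mate i v) ≡⟨ cong (λ j → mate j (mate i v)) (sym (colour-sym K (~mate i v))) ⟩
      mate (colour K v (mate i v)) (mate i v) ≡⟨ cong (λ j → mate j (mate i v)) (colour-mate i v) ⟩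
      mate i (mate i v)                       ∎)
      where open ≡-Reasoning

    mate-injective : ∀ i {v w} → mate i v ≡ mate i w → v ≡ w
    mate-injective i {v} {w} eq = trans (sym (mate-involutive i v)) (trans (cong (mate i) eq) (mate-involutive i w))

    mate-≢ : ∀ {i j} v → i ≢ j → mate i v ≢ mate j v
    mate-≢ {i} {j} v i≢j eq = i≢j (trans (sym (colour-mate i v)) (trans (cong (colour K v) eq) (colour-mate j v)))

  module _ (cubic : Cubic G) (bipartite : Bipartite G) (c4-free : C4Free G) where

    private
      c : V → Bool
      c = proj₁ bipartite

      c-proper : ∀ {x y} → x ~ y → c x ≢ c y
      c-proper = proj₂ bipartite _ _

      opaque
        K : ProperColouring _~_ 3
        K = bipartite⇒edgeColouring bipartite (≤-reflexive ∘ cubic)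

    open PerfectMatchings K cubic

    μ₀ μ₁ μ₂ : V → V
    μ₀ = mate zero
    μ₁ = mate (suc zero)
    μ₂ = mate (suc (suc zero))

    c-mate : ∀ i v → c (mate i v) ≡ not (c v)
    c-mate i v = ¬-not (c-proper (~-sym (~mate i v)))

    c-mate² : ∀ i j v → c (mate i (mate j v)) ≡ c v
    c-mate² i j v = trans (c-mate i _) (trans (cong not (c-mate j v)) (not-involutive (c v)))

    noSquare : ∀ {a b a′ b′} → a ≢ a′ → b ≢ b′ → a ~ b → b ~ a′ → a′ ~ b′ → b′ ~ a → ⊥
    noSquare a≢a′ b≢b′ a~b b~a′ a′~b′ b′~a = c4-free _ _ _ _
      (~⇒≢ a~b) a≢a′ (~⇒≢ (~-sym b′~a)) (~⇒≢ b~a′) b≢b′ (~⇒≢ a′~b′) (a~b , b~a′ , a′~b′ , b′~a)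

    neighbour-cases : ∀ {v w} → v ~ w → w ≢ μ₁ v → w ≡ μ₀ v ⊎ w ≡ μ₂ v
    neighbour-cases {v} {w} v~w w≢μ₁v with colour K v w | ~⇒mate v~w
    ... | zero | w≡ = inj₁ w≡
    ... | suc zero | w≡ = contradiction w≡ w≢μ₁v
    ... | suc (suc zero) | w≡ = inj₂ w≡

    PointOrNonNeighbour : V → V → Bool → V → Set
    PointOrNonNeighbour w z s x = x ≡ w ⊎ (c x ≡ s × ¬ z ~ x)

    pointOrNonNeighbour? : ∀ w z s x → Dec (PointOrNonNeighbour w z s x)
    pointOrNonNeighbour? w z s x = x ≟ w ⊎-dec (c x B.≟ s ×-dec ¬? (adj G z x B.≟ true))

    pointAndNonNeighbours : V → V → Bool → Subset (n G)
    pointAndNonNeighbours w z s = subsetOf (pointOrNonNeighbour? w z s)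

    pointAndNonNeighbours-stable : ∀ {w z s} → c w ≡ s ⊎ w ≡ z → Stable G (pointAndNonNeighbours w z s)
    pointAndNonNeighbours-stable {w} {z} {s} centre x y x∈ y∈ =
      ¬-not (independent (∈-subsetOf⁻ P? x∈) (∈-subsetOf⁻ P? y∈))
      where
      P? : ∀ x → Dec (PointOrNonNeighbour w z s x)
      P? = pointOrNonNeighbour? w z s

      centre-independent : ∀ {y} → c y ≡ s → ¬ z ~ y → ¬ w ~ y
      centre-independent {y} cy ¬z~y w~y = Sum.[ (λ cw → c-proper w~y (trans cw (sym cy))) ,
                                                 (λ w≡z → ¬z~y (subst (_~ y) w≡z w~y)) ] centre

      independent : ∀ {x y} → PointOrNonNeighbour w z s x → PointOrNonNeighbour w z s y → ¬ x ~ y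
      independent (inj₁ refl) (inj₁ refl) x~y = ~⇒≢ x~y refl
      independent (inj₂ (cx , _)) (inj₂ (cy , _)) x~y = c-proper x~y (trans cx (sym cy))
      independent (inj₁ refl) (inj₂ (cy , ¬z~y)) = centre-independent cy ¬z~y
      independent (inj₂ (cx , ¬z~x)) (inj₁ refl) = centre-independent cx ¬z~x ∘ ~-sym

    ∉-pointAndNonNeighbours⁻ : ∀ {w z s x} → x ∉ₛ pointAndNonNeighbours w z s → x ≢ w × (c x ≡ s → z ~ x)
    ∉-pointAndNonNeighbours⁻ {w} {z} {s} {x} x∉ =
      ¬P ∘ inj₁ , λ cx → decidable-stable (adj G z x B.≟ true) (λ ¬z~x → ¬P (inj₂ (cx , ¬z~x)))
      where
      ¬P : ¬ PointOrNonNeighbour w z s x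
      ¬P = ∉-subsetOf⁻ (pointOrNonNeighbour? w z s) x∉

    ∉-pointAndNonNeighbours⁺ : ∀ {w z s x} → x ≢ w → (c x ≡ s → z ~ x) → x ∉ₛ pointAndNonNeighbours w z s
    ∉-pointAndNonNeighbours⁺ {w} {z} {s} x≢w z~x =
      ∉-subsetOf⁺ (pointOrNonNeighbour? w z s) Sum.[ x≢w , (λ (cx , ¬z~x) → ¬z~x (z~x cx)) ]

    -- The stable set of the edge joining a to mate i a, for a on side true.
    stableSet : Fin 3 → V → Subset (n G)
    stableSet zero a = pointAndNonNeighbours (μ₁ (μ₀ a)) (μ₀ a) true
    stableSet (suc zero) a = pointAndNonNeighbours (μ₁ (μ₀ (μ₁ a))) (μ₀ (μ₁ a)) false
    stableSet (suc (suc zero)) a = pointAndNonNeighbours (μ₀ a) (μ₀ a) true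

    c-μ₁μ₀μ₁ : ∀ {a} → c a ≡ true → c (μ₁ (μ₀ (μ₁ a))) ≡ false
    c-μ₁μ₀μ₁ ca = trans (c-mate _ _) (cong not (trans (c-mate² _ _ _) ca))

    stableSet-stable : ∀ {a} → c a ≡ true → ∀ i → Stable G (stableSet i a)
    stableSet-stable {a} ca zero = pointAndNonNeighbours-stable (inj₁ (trans (c-mate² _ _ a) ca))
    stableSet-stable {a} ca (suc zero) = pointAndNonNeighbours-stable (inj₁ (c-μ₁μ₀μ₁ ca))
    stableSet-stable {a} ca (suc (suc zero)) = pointAndNonNeighbours-stable (inj₂ refl)

    stableSet-avoidsEdge : ∀ {a} → c a ≡ true → ∀ i → a ∉ₛ stableSet i a × mate i a ∉ₛ stableSet i a
    stableSet-avoidsEdge {a} ca zero =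
      ∉-pointAndNonNeighbours⁺ (λ a≡ → mate-≢ (μ₀ a) (λ ()) (trans (mate-involutive _ a) a≡))
        (λ _ → ~-sym (~mate _ a)) ,
      ∉-pointAndNonNeighbours⁺ (~⇒≢ (~mate _ (μ₀ a)))
        (λ cμ₀a → contradiction (trans ca (sym cμ₀a)) (c-proper (~mate _ a)))
    stableSet-avoidsEdge {a} ca (suc zero) =
      ∉-pointAndNonNeighbours⁺ (λ a≡ → contradiction (trans (sym ca) (trans (cong c a≡) (c-μ₁μ₀μ₁ ca))) λ ())
        (λ ca≡false → contradiction (trans (sym ca) ca≡false) λ ()) ,
      ∉-pointAndNonNeighbours⁺ (λ μ₁a≡ → mate-≢ (μ₀ (μ₁ a)) (λ ()) (trans (mate-involutive _ _) μ₁a≡))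
        (λ _ → ~-sym (~mate _ (μ₁ a)))
    stableSet-avoidsEdge {a} ca (suc (suc zero)) =
      ∉-pointAndNonNeighbours⁺ (~⇒≢ (~mate _ a)) (λ _ → ~-sym (~mate _ a)) ,
      ∉-pointAndNonNeighbours⁺ (mate-≢ a (λ ()))
        (λ cμ₂a → contradiction (trans ca (sym cμ₂a)) (c-proper (~mate _ a)))

    -- What it takes for an edge a′b′ (a′ on side true) to miss stableSet i a.
    Avoids : Fin 3 → V → V → V → Set
    Avoids zero a a′ b′ = a′ ≡ a ⊎ a′ ≡ μ₂ (μ₀ a)
    Avoids (suc zero) a a′ b′ = b′ ≡ μ₁ a ⊎ b′ ≡ μ₂ (μ₀ (μ₁ a))
    Avoids (suc (suc zero)) a a′ b′ = μ₀ a ~ a′ × b′ ≢ μ₀ a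

    disjoint⇒avoids : ∀ i {a a′ b′} → c a′ ≡ true → a′ ~ b′ →
      a′ ∉ₛ stableSet i a → b′ ∉ₛ stableSet i a → Avoids i a a′ b′
    disjoint⇒avoids zero {a} ca′ _ a′∉ _ with ∉-pointAndNonNeighbours⁻ a′∉
    ... | a′≢ , μ₀a~ = Sum.map₁ (λ a′≡ → trans a′≡ (mate-involutive _ a)) (neighbour-cases (μ₀a~ ca′) a′≢)
    disjoint⇒avoids (suc zero) {a} ca′ a′~b′ _ b′∉ with ∉-pointAndNonNeighbours⁻ b′∉
    ... | b′≢ , μ₀μ₁a~ = Sum.map₁ (λ b′≡ → trans b′≡ (mate-involutive _ (μ₁ a))) (neighbour-cases (μ₀μ₁a~ cb′) b′≢)
      where
      cb′ : c _ ≡ false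
      cb′ = trans (¬-not (c-proper (~-sym a′~b′))) (cong not ca′)
    disjoint⇒avoids (suc (suc zero)) ca′ _ a′∉ b′∉ =
      proj₂ (∉-pointAndNonNeighbours⁻ a′∉) ca′ , proj₁ (∉-pointAndNonNeighbours⁻ b′∉)

    ≡mate⇒~ : ∀ {i v w} → w ≡ mate i v → v ~ w
    ≡mate⇒~ {i} {v} w≡ = subst (v ~_) (sym w≡) (~mate i v)

    avoids-00 : ∀ {a a′} → Avoids zero a a′ (μ₀ a′) → Avoids zero a′ a (μ₀ a) → a ≡ a′
    avoids-00 (inj₁ a′≡a) _ = sym a′≡a
    avoids-00 (inj₂ _) (inj₁ a≡a′) = a≡a′
    avoids-00 {a} {a′} (inj₂ a′≡) (inj₂ a≡) with a ≟ a′
    ... | yes a≡a′ = a≡a′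
    ... | no a≢a′ =
      ⊥-elim (noSquare a≢a′ (a≢a′ ∘ mate-injective _) (~mate _ a) (≡mate⇒~ a′≡) (~mate _ a′) (≡mate⇒~ a≡))

    avoids-11 : ∀ {a a′} → Avoids (suc zero) a a′ (μ₁ a′) → Avoids (suc zero) a′ a (μ₁ a) → a ≡ a′
    avoids-11 (inj₁ b′≡b) _ = sym (mate-injective _ b′≡b)
    avoids-11 (inj₂ _) (inj₁ b≡b′) = mate-injective _ b≡b′
    avoids-11 {a} {a′} (inj₂ b′≡) (inj₂ b≡) with a ≟ a′
    ... | yes a≡a′ = a≡a′
    ... | no a≢a′ = ⊥-elim (noSquare (a≢a′ ∘ mate-injective _ ∘ mate-injective _) (a≢a′ ∘ sym ∘ mate-injective _)
                             (≡mate⇒~ b′≡) (~mate _ (μ₁ a′)) (≡mate⇒~ b≡) (~mate _ (μ₁ a)))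

    avoids-22 : ∀ {a a′} → Avoids (suc (suc zero)) a a′ (μ₂ a′) → Avoids (suc (suc zero)) a′ a (μ₂ a) → a ≡ a′
    avoids-22 {a} {a′} (μ₀a~a′ , _) (μ₀a′~a , _) with a ≟ a′
    ... | yes a≡a′ = a≡a′
    ... | no a≢a′ = ⊥-elim (noSquare a≢a′ (a≢a′ ∘ mate-injective _) (~mate _ a) μ₀a~a′ (~mate _ a′) μ₀a′~a)

    avoids-02 : ∀ {a a′} → Avoids zero a a′ (μ₂ a′) → Avoids (suc (suc zero)) a′ a (μ₀ a) → ⊥
    avoids-02 (inj₁ refl) (_ , μ₀a≢μ₀a′) = μ₀a≢μ₀a′ refl
    avoids-02 {a} (inj₂ a′≡) (μ₀a′~a , μ₀a≢μ₀a′) =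
      noSquare (μ₀a≢μ₀a′ ∘ cong μ₀) μ₀a≢μ₀a′ (~mate _ a) (≡mate⇒~ a′≡) (~mate _ _) μ₀a′~a

    avoids-01 : ∀ {a a′} → Avoids zero a a′ (μ₁ a′) → Avoids (suc zero) a′ a (μ₀ a) → ⊥
    avoids-01 {a} {a′} F (inj₁ b≡b′) with F
    ... | inj₁ a′≡a = mate-≢ (μ₀ a) (λ ()) (trans (sym a′≡μ₁b) (trans a′≡a (sym (mate-involutive _ a))))
      where a′≡μ₁b = trans (sym (mate-involutive _ a′)) (cong μ₁ (sym b≡b′))
    ... | inj₂ a′≡ = mate-≢ (μ₀ a) (λ ()) (trans (sym a′≡μ₁b) a′≡)
      where a′≡μ₁b = trans (sym (mate-involutive _ a′)) (cong μ₁ (sym b≡b′))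
    avoids-01 {a} (inj₁ refl) (inj₂ b≡) =
      noSquare (λ a≡ → mate-≢ (μ₁ a) (λ ()) (trans (mate-involutive _ a) a≡)) (mate-≢ a (λ ()))
        (~mate _ a) (~-sym (≡mate⇒~ b≡)) (~-sym (~mate _ (μ₁ a))) (~-sym (~mate _ a))
    avoids-01 {a} {a′} (inj₂ a′≡) (inj₂ b≡) = mate-≢ (μ₁ a′) (λ ()) (trans μ₀b′≡a′ (sym (mate-involutive _ a′)))
      where
      μ₀b′≡a′ : μ₀ (μ₁ a′) ≡ a′
      μ₀b′≡a′ = trans (sym (mate-involutive _ _)) (trans (cong μ₂ (sym b≡)) (sym a′≡))

    avoids-21 : ∀ {a a′} → Avoids (suc (suc zero)) a a′ (μ₁ a′) → Avoids (suc zero) a′ a (μ₂ a) → ⊥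
    avoids-21 {a} (μ₀a~a′ , _) (inj₁ b≡b′) =
      noSquare (λ a≡a′ → mate-≢ a (λ ()) (trans b≡b′ (cong μ₁ (sym a≡a′)))) (mate-≢ a (λ ()))
        (~mate _ a) μ₀a~a′ (≡mate⇒~ b≡b′) (~-sym (~mate _ a))
    avoids-21 (_ , b′≢μ₀a) (inj₂ b≡) =
      b′≢μ₀a (sym (trans (cong μ₀ (mate-injective _ b≡)) (mate-involutive _ _)))

    avoid-each-other : ∀ i j {a a′} → Avoids i a a′ (mate j a′) → Avoids j a′ a (mate i a) → i ≡ j × a ≡ a′
    avoid-each-other zero zero F F′ = refl , avoids-00 F F′
    avoid-each-other zero (suc zero) F F′ = ⊥-elim (avoids-01 F F′)
    avoid-each-other zero (suc (suc zero)) F F′ = ⊥-elim (avoids-02 F F′)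
    avoid-each-other (suc zero) zero F F′ = ⊥-elim (avoids-01 F′ F)
    avoid-each-other (suc zero) (suc zero) F F′ = refl , avoids-11 F F′
    avoid-each-other (suc zero) (suc (suc zero)) F F′ = ⊥-elim (avoids-21 F′ F)
    avoid-each-other (suc (suc zero)) zero F F′ = ⊥-elim (avoids-02 F′ F)
    avoid-each-other (suc (suc zero)) (suc zero) F F′ = ⊥-elim (avoids-21 F F′)
    avoid-each-other (suc (suc zero)) (suc (suc zero)) F F′ = refl , avoids-22 F F′

    leftEnd : V → V → V
    leftEnd u v = if c u then u else v

    Ends : Fin 3 → V → V → V → Set
    Ends i a u v = (u ≡ a × v ≡ mate i a) ⊎ (u ≡ mate i a × v ≡ a)

    edge-ends : ∀ {u v} → u ~ v → c (leftEnd u v) ≡ true × Ends (colour K u v) (leftEnd u v) u v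
    edge-ends {u} {v} u~v with c u in cu
    ... | true = cu , inj₁ (refl , ~⇒mate u~v)
    ... | false = trans (¬-not (c-proper (~-sym u~v))) (cong not cu) ,
                  inj₂ (trans (~⇒mate (~-sym u~v)) (cong (λ i → mate i v) (sym (colour-sym K u~v))) , refl)

    ∉-ends⁻ : ∀ {i a u v S} → Ends i a u v → u ∉ₛ S → v ∉ₛ S → a ∉ₛ S × mate i a ∉ₛ S
    ∉-ends⁻ (inj₁ (refl , refl)) u∉ v∉ = u∉ , v∉
    ∉-ends⁻ (inj₂ (refl , refl)) u∉ v∉ = v∉ , u∉

    ∉-ends⁺ : ∀ {i a u v S} → Ends i a u v → a ∉ₛ S → mate i a ∉ₛ S → u ∉ₛ S × v ∉ₛ S
    ∉-ends⁺ (inj₁ (refl , refl)) a∉ b∉ = a∉ , b∉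
    ∉-ends⁺ (inj₂ (refl , refl)) a∉ b∉ = b∉ , a∉

    ends-unique : ∀ {i a u v u′ v′} → toℕ u < toℕ v → toℕ u′ < toℕ v′ →
      Ends i a u v → Ends i a u′ v′ → (u , v) ≡ (u′ , v′)
    ends-unique _ _ (inj₁ (refl , refl)) (inj₁ (refl , refl)) = refl
    ends-unique _ _ (inj₂ (refl , refl)) (inj₂ (refl , refl)) = refl
    ends-unique u<v u′<v′ (inj₁ (refl , refl)) (inj₂ (refl , refl)) = ⊥-elim (<-asym u<v u′<v′)
    ends-unique u<v u′<v′ (inj₂ (refl , refl)) (inj₁ (refl , refl)) = ⊥-elim (<-asym u<v u′<v′)

    stableSetOf : V × V → Subset (n G)
    stableSetOf (u , v) = stableSet (colour K u v) (leftEnd u v)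

    edge-inSupport : ∀ {e} → IsEdge G e → InSupport G (e , stableSetOf e)
    edge-inSupport {u , v} (u<v , u~v) with edge-ends u~v
    ... | ca , ends =
      (u<v , u~v) , stableSet-stable ca (colour K u v) , uncurry (∉-ends⁺ ends) (stableSet-avoidsEdge ca _)

    edges-fool : ∀ {e e′} → IsEdge G e → IsEdge G e′ →
      Disjoint G e (stableSetOf e′) → Disjoint G e′ (stableSetOf e) → e ≡ e′
    edges-fool {u , v} {u′ , v′} (u<v , u~v) (u′<v′ , u′~v′) (u∉ , v∉) (u′∉ , v′∉)
      with edge-ends u~v | edge-ends u′~v′
    ... | ca , ends | ca′ , ends′
      with avoid-each-other (colour K u v) (colour K u′ v′)
             (uncurry (disjoint⇒avoids _ ca′ (~mate _ _)) (∉-ends⁻ ends′ u′∉ v′∉))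
             (uncurry (disjoint⇒avoids _ ca (~mate _ _)) (∉-ends⁻ ends u∉ v∉))
    ... | i≡j , a≡a′ = ends-unique u<v u′<v′ ends (subst₂ (λ i a → Ends i a u′ v′) (sym i≡j) (sym a≡a′) ends′)

    entryOf : V × V → Entry G
    entryOf e = e , stableSetOf e

    foolingSet : FoolingSet G
    foolingSet = record
      { entries = map entryOf edges
      ; distinct = map⁺ (cong proj₁) edges-unique
      ; support = inSupport
      ; fooling = isFooling
      }
      where
      inSupport : ∀ x → x ∈ map entryOf edges → InSupport G x
      inSupport x x∈ with ∈-map⁻ entryOf x∈
      ... | e , e∈ , refl = edge-inSupport (∈-edges⁻ e∈)

      isFooling : ∀ e f S T → (e , S) ∈ map entryOf edges → (f , T) ∈ map entryOf edges → (e , S) ≢ (f , T) →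
        ¬ (Disjoint G e T × Disjoint G f S)
      isFooling _ _ _ _ eS∈ fT∈ eS≢fT (e∩T , f∩S) with ∈-map⁻ entryOf eS∈ | ∈-map⁻ entryOf fT∈
      ... | e , e∈ , refl | f , f∈ , refl = eS≢fT (cong entryOf (edges-fool (∈-edges⁻ e∈) (∈-edges⁻ f∈) e∩T f∩S))

    size-foolingSet : size foolingSet ≡ numEdges G
    size-foolingSet = trans (length-map entryOf edges) length-edges

theorem4 : (G : Graph) → Cubic G → Bipartite G → C4Free G →
    Σ (FoolingSet G) λ F → size F ≡ numEdges G
theorem4 G cubic bipartite c4-free =
  foolingSet G cubic bipartite c4-free , size-foolingSet G cubic bipartite c4-free
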